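{- Let $x\geq 1$ and $y\geq 3$ be integers and let $s\geq 1$ be the integer with $$(s-1)s\left(\frac{y}{2}-1\right)+s-1<x\leq s(s+1)\left(\frac{y}{2}-1\right)+s.$$ Then $$\min\left\{\left\lceil\left(\frac{x}{m}+\frac{y}{n}-1\right)(m+n-1)\right\rceil : m,n\in\mathbb{Z},\ x\geq m\geq 1,\ \frac{y}{3}+1\geq n\geq 2\right\}=\left\lceil\left(\frac{x}{s}+\frac{y}{2}-1\right)(s+1)\right\rceil.$$ -}

module Defs where

open import Data.Nat using (ℕ; zero; suc)
open import Data.Integer using (+_)
open import Data.Rational using (ℚ; _/_; 0ℚ)

⟦_⟧ : ℕ → ℚ
⟦ n ⟧ = + n / 1

-- a / b as a rational; only ever used with b ≥ 1 (value at b = 0 is an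
-- irrelevant junk convention)
_//_ : ℕ → ℕ → ℚ
a // zero  = 0ℚ
a // suc b = + a / suc b
infixl 7 _//_

{-# OPTIONS --safe #-}
module Submission where

-- Let f(m, n) = (x/m + y/n − 1)(m + n − 1), fix an integer K and call (m, n) feasible when
-- f(m, n) ≤ K. As ⌈f⌉ ≤ K iff f ≤ K, it suffices that feasibility of an admissible (m, n)
-- implies feasibility of (s, 2). Clearing denominators, with ℓ = K − x ≥ 0, turns feasibility
-- into a polynomial inequality over ℕ. With k = n − 1 and y ≥ 3k, write m = ak + r with r < k:
-- if a = 0 then (1, 2) is feasible, and otherwise (a, 2) or (a + 1, 2) is, since the failures at
-- a and a + 1, weighted by k − r and r (interpolating at m/k), contradict feasibility of (m, n).
-- For n = 2 and b = y − 2, 2x/q + bq ≤ 2x/p + bp for p < q exactly when bpq ≤ 2x, and the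
-- bounds on x make s the best choice once one uses that ℓ is an integer.

module Ceiling where
  import Data.Nat.Base as ℕ
  open import Data.Nat.Coprimality using (Coprime)
  open import Data.Integer.Base using (∣_∣; +_; +[1+_]; -[1+_]; -_; _*_; _≤_; _<_; suc; _/_; _/ℕ_)
  open import Data.Integer.DivMod using ([n/d]*d≤n; n<s[n/ℕd]*d; div-pos-is-/ℕ)
  open import Data.Integer.Properties
  open import Data.Rational.Base using (mkℚ; ceiling; toℚᵘ)
  open import Data.Rational.Unnormalised.Base as ℚᵘ using (*≤*) renaming (_≤_ to _≤ᵘ_)
  open import Relation.Binary.PropositionalEquality

  ceiling-mkℚ : ∀ n d .(c : Coprime ∣ n ∣ (ℕ.suc d)) → ceiling (mkℚ n d c) ≡ - ((- n) / + ℕ.suc d)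
  ceiling-mkℚ (+ 0)    d c = refl
  ceiling-mkℚ +[1+ n ] d c = refl
  ceiling-mkℚ -[1+ n ] d c = refl

  p≤⌈p⌉ : ∀ p → toℚᵘ p ≤ᵘ ceiling p ℚᵘ./ 1
  p≤⌈p⌉ (mkℚ n d c) rewrite ceiling-mkℚ n d c = *≤* (begin
    n * + 1            ≡⟨ *-identityʳ n ⟩
    n                  ≡⟨ neg-involutive n ⟨
    - (- n)            ≤⟨ neg-mono-≤ ([n/d]*d≤n (- n) D) ⟩
    - ((- n) / D * D)  ≡⟨ neg-distribˡ-* ((- n) / D) D ⟩
    - ((- n) / D) * D  ∎)
    where
    open ≤-Reasoning
    D = + ℕ.suc d

  p≤K⇒⌈p⌉≤K : ∀ p K → toℚᵘ p ≤ᵘ K ℚᵘ./ 1 → ceiling p ≤ K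
  p≤K⇒⌈p⌉≤K (mkℚ n d c) K (*≤* n≤KD) rewrite ceiling-mkℚ n d c =
    subst (- q ≤_) (neg-involutive K) (neg-mono-≤ -K≤q)
    where
    D = + ℕ.suc d
    q = (- n) / D
    -KD<[1+q]D : - K * D < suc q * D
    -KD<[1+q]D = begin-strict
      - K * D                      ≡⟨ neg-distribˡ-* K D ⟨
      - (K * D)                    ≤⟨ neg-mono-≤ (subst (_≤ K * D) (*-identityʳ n) n≤KD) ⟩
      - n                          <⟨ n<s[n/ℕd]*d (- n) (ℕ.suc d) ⟩
      suc ((- n) /ℕ ℕ.suc d) * D   ≡⟨ cong (λ z → suc z * D) (div-pos-is-/ℕ (- n) (ℕ.suc d)) ⟨
      suc q * D                    ∎
      where open ≤-Reasoning
    -K≤q : - K ≤ q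
    -K≤q = subst₂ _≤_ (pred-suc (- K)) (pred-suc q)
             (pred-mono (i<j⇒suc[i]≤j (*-cancelʳ-<-nonNeg {i = - K} {j = suc q} D -KD<[1+q]D)))

module RationalExpression where
  open import Data.Nat.Base using (ℕ; suc)
  open import Data.Integer.Base as ℤ using (ℤ; +_)
  open import Data.Integer.Properties as ℤ using ()
  open import Data.Rational.Base as ℚ using (ℚ; 1ℚ; toℚᵘ; ceiling)
  open import Data.Rational.Properties as ℚ using ()
  open import Data.Rational.Unnormalised.Base as ℚᵘ using (ℚᵘ; mkℚᵘ; *≤*; *<*; *≡*)
  open import Data.Rational.Unnormalised.Properties as ℚᵘ using ()
  open import Relation.Binary.PropositionalEquality
  open import Defs
  open Ceiling

  infixl 6 _‵+_ _‵-_
  infixl 7 _‵*_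

  data Expr : Set where
    ‵_             : ℕ → Expr
    ‵_/1+_         : ℕ → ℕ → Expr
    ‵1             : Expr
    _‵+_ _‵*_ _‵-_ : Expr → Expr → Expr

  ⟦_⟧ℚ : Expr → ℚ
  ⟦ ‵ k ⟧ℚ       = ⟦ k ⟧
  ⟦ ‵ a /1+ d ⟧ℚ = a // suc d
  ⟦ ‵1 ⟧ℚ        = 1ℚ
  ⟦ e ‵+ f ⟧ℚ    = ⟦ e ⟧ℚ ℚ.+ ⟦ f ⟧ℚ
  ⟦ e ‵* f ⟧ℚ    = ⟦ e ⟧ℚ ℚ.* ⟦ f ⟧ℚ
  ⟦ e ‵- f ⟧ℚ    = ⟦ e ⟧ℚ ℚ.- ⟦ f ⟧ℚ

  ⟦_⟧ᵘ : Expr → ℚᵘ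
  ⟦ ‵ k ⟧ᵘ       = mkℚᵘ (+ k) 0
  ⟦ ‵ a /1+ d ⟧ᵘ = mkℚᵘ (+ a) d
  ⟦ ‵1 ⟧ᵘ        = mkℚᵘ (+ 1) 0
  ⟦ e ‵+ f ⟧ᵘ    = ⟦ e ⟧ᵘ ℚᵘ.+ ⟦ f ⟧ᵘ
  ⟦ e ‵* f ⟧ᵘ    = ⟦ e ⟧ᵘ ℚᵘ.* ⟦ f ⟧ᵘ
  ⟦ e ‵- f ⟧ᵘ    = ⟦ e ⟧ᵘ ℚᵘ.- ⟦ f ⟧ᵘ

  num den : Expr → ℤ
  num e = ℚᵘ.↥ ⟦ e ⟧ᵘ
  den e = ℚᵘ.↧ ⟦ e ⟧ᵘ

  toℚᵘ-⟦⟧ : ∀ e → toℚᵘ ⟦ e ⟧ℚ ℚᵘ.≃ ⟦ e ⟧ᵘ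
  toℚᵘ-⟦⟧ (‵ k)       = ℚ.toℚᵘ-fromℚᵘ (mkℚᵘ (+ k) 0)
  toℚᵘ-⟦⟧ (‵ a /1+ d) = ℚ.toℚᵘ-fromℚᵘ (mkℚᵘ (+ a) d)
  toℚᵘ-⟦⟧ ‵1          = ℚ.toℚᵘ-fromℚᵘ (mkℚᵘ (+ 1) 0)
  toℚᵘ-⟦⟧ (e ‵+ f)    =
    ℚᵘ.≃-trans (ℚ.toℚᵘ-homo-+ ⟦ e ⟧ℚ ⟦ f ⟧ℚ) (ℚᵘ.+-cong (toℚᵘ-⟦⟧ e) (toℚᵘ-⟦⟧ f))
  toℚᵘ-⟦⟧ (e ‵* f)    =
    ℚᵘ.≃-trans (ℚ.toℚᵘ-homo-* ⟦ e ⟧ℚ ⟦ f ⟧ℚ) (ℚᵘ.*-cong (toℚᵘ-⟦⟧ e) (toℚᵘ-⟦⟧ f))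
  toℚᵘ-⟦⟧ (e ‵- f)    = ℚᵘ.≃-trans (ℚ.toℚᵘ-homo-+ ⟦ e ⟧ℚ (ℚ.- ⟦ f ⟧ℚ))
    (ℚᵘ.+-cong (toℚᵘ-⟦⟧ e) (ℚᵘ.≃-trans (ℚ.toℚᵘ-homo‿- ⟦ f ⟧ℚ) (ℚᵘ.-‿cong (toℚᵘ-⟦⟧ f))))

  ≤⇒cross-≤ : ∀ e f → ⟦ e ⟧ℚ ℚ.≤ ⟦ f ⟧ℚ → num e ℤ.* den f ℤ.≤ num f ℤ.* den e
  ≤⇒cross-≤ e f e≤f
    with ℚᵘ.≤-respʳ-≃ (toℚᵘ-⟦⟧ f) (ℚᵘ.≤-respˡ-≃ (toℚᵘ-⟦⟧ e) (ℚ.toℚᵘ-mono-≤ e≤f))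
  ... | *≤* cross = cross

  cross-≤⇒≤ : ∀ e f → num e ℤ.* den f ℤ.≤ num f ℤ.* den e → ⟦ e ⟧ℚ ℚ.≤ ⟦ f ⟧ℚ
  cross-≤⇒≤ e f cross = ℚ.toℚᵘ-cancel-≤
    (ℚᵘ.≤-respˡ-≃ (ℚᵘ.≃-sym (toℚᵘ-⟦⟧ e)) (ℚᵘ.≤-respʳ-≃ (ℚᵘ.≃-sym (toℚᵘ-⟦⟧ f)) (*≤* cross)))

  <⇒cross-< : ∀ e f → ⟦ e ⟧ℚ ℚ.< ⟦ f ⟧ℚ → num e ℤ.* den f ℤ.< num f ℤ.* den e
  <⇒cross-< e f e<f
    with ℚᵘ.<-respʳ-≃ (toℚᵘ-⟦⟧ f) (ℚᵘ.<-respˡ-≃ (toℚᵘ-⟦⟧ e) (ℚ.toℚᵘ-mono-< e<f))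
  ... | *<* cross = cross

  cross-≡⇒≡ : ∀ e f → num e ℤ.* den f ≡ num f ℤ.* den e → ⟦ e ⟧ℚ ≡ ⟦ f ⟧ℚ
  cross-≡⇒≡ e f cross = ℚ.toℚᵘ-injective
    (ℚᵘ.≃-trans (toℚᵘ-⟦⟧ e) (ℚᵘ.≃-trans (*≡* cross) (ℚᵘ.≃-sym (toℚᵘ-⟦⟧ f))))

  ceiling≤⇒num≤ : ∀ e K → ceiling ⟦ e ⟧ℚ ℤ.≤ K → num e ℤ.≤ K ℤ.* den e
  ceiling≤⇒num≤ e K ⌈e⌉≤K with ℚᵘ.≤-respˡ-≃ (toℚᵘ-⟦⟧ e) (ℚᵘ.≤-trans (p≤⌈p⌉ ⟦ e ⟧ℚ) ⌈e⌉≤K/1)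
    where
    ⌈e⌉≤K/1 : ceiling ⟦ e ⟧ℚ ℚᵘ./ 1 ℚᵘ.≤ K ℚᵘ./ 1
    ⌈e⌉≤K/1 = *≤* (ℤ.*-monoʳ-≤-nonNeg (+ 1) ⌈e⌉≤K)
  ... | *≤* cross = subst (ℤ._≤ K ℤ.* den e) (ℤ.*-identityʳ (num e)) cross

  num≤⇒ceiling≤ : ∀ e K → num e ℤ.≤ K ℤ.* den e → ceiling ⟦ e ⟧ℚ ℤ.≤ K
  num≤⇒ceiling≤ e K num≤ = p≤K⇒⌈p⌉≤K ⟦ e ⟧ℚ K (ℚᵘ.≤-respˡ-≃ (ℚᵘ.≃-sym (toℚᵘ-⟦⟧ e)) e≤K/1)
    where
    e≤K/1 : ⟦ e ⟧ᵘ ℚᵘ.≤ K ℚᵘ./ 1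
    e≤K/1 = *≤* (subst (ℤ._≤ K ℤ.* den e) (sym (ℤ.*-identityʳ (num e))) num≤)

module NatPolynomial where
  open import Data.Nat.Base as ℕ using (ℕ)
  open import Data.Integer.Base as ℤ using (ℤ; +_; +≤+)
  open import Data.Integer.Properties as ℤ using ()
  open import Relation.Binary.PropositionalEquality

  infixl 6 _:+_
  infixl 7 _:*_

  data Poly : Set where
    ⌜_⌝       : ℕ → Poly
    _:+_ _:*_ : Poly → Poly → Poly

  ⟦_⟧ℕ : Poly → ℕ
  ⟦ ⌜ n ⌝ ⟧ℕ  = n
  ⟦ p :+ q ⟧ℕ = ⟦ p ⟧ℕ ℕ.+ ⟦ q ⟧ℕ
  ⟦ p :* q ⟧ℕ = ⟦ p ⟧ℕ ℕ.* ⟦ q ⟧ℕ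

  ⟦_⟧ℤ : Poly → ℤ
  ⟦ ⌜ n ⌝ ⟧ℤ  = + n
  ⟦ p :+ q ⟧ℤ = ⟦ p ⟧ℤ ℤ.+ ⟦ q ⟧ℤ
  ⟦ p :* q ⟧ℤ = ⟦ p ⟧ℤ ℤ.* ⟦ q ⟧ℤ

  ⟦⟧ℤ≡+⟦⟧ℕ : ∀ p → ⟦ p ⟧ℤ ≡ + ⟦ p ⟧ℕ
  ⟦⟧ℤ≡+⟦⟧ℕ ⌜ n ⌝    = refl
  ⟦⟧ℤ≡+⟦⟧ℕ (p :+ q) =
    trans (cong₂ ℤ._+_ (⟦⟧ℤ≡+⟦⟧ℕ p) (⟦⟧ℤ≡+⟦⟧ℕ q)) (sym (ℤ.pos-+ ⟦ p ⟧ℕ ⟦ q ⟧ℕ))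
  ⟦⟧ℤ≡+⟦⟧ℕ (p :* q) =
    trans (cong₂ ℤ._*_ (⟦⟧ℤ≡+⟦⟧ℕ p) (⟦⟧ℤ≡+⟦⟧ℕ q)) (sym (ℤ.pos-* ⟦ p ⟧ℕ ⟦ q ⟧ℕ))

  ≤-fromℤ : ∀ p q → ⟦ p ⟧ℤ ℤ.≤ ⟦ q ⟧ℤ → ⟦ p ⟧ℕ ℕ.≤ ⟦ q ⟧ℕ
  ≤-fromℤ p q p≤q = ℤ.drop‿+≤+ (subst₂ ℤ._≤_ (⟦⟧ℤ≡+⟦⟧ℕ p) (⟦⟧ℤ≡+⟦⟧ℕ q) p≤q)

  <-fromℤ : ∀ p q → ⟦ p ⟧ℤ ℤ.< ⟦ q ⟧ℤ → ⟦ p ⟧ℕ ℕ.< ⟦ q ⟧ℕ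
  <-fromℤ p q p<q = ℤ.drop‿+<+ (subst₂ ℤ._<_ (⟦⟧ℤ≡+⟦⟧ℕ p) (⟦⟧ℤ≡+⟦⟧ℕ q) p<q)

  ≤-toℤ : ∀ p q → ⟦ p ⟧ℕ ℕ.≤ ⟦ q ⟧ℕ → ⟦ p ⟧ℤ ℤ.≤ ⟦ q ⟧ℤ
  ≤-toℤ p q p≤q = subst₂ ℤ._≤_ (sym (⟦⟧ℤ≡+⟦⟧ℕ p)) (sym (⟦⟧ℤ≡+⟦⟧ℕ q)) (+≤+ p≤q)

module Budget where
  open import Data.Nat.Base using (ℕ; suc; _+_; _*_; _≤_)
  open import Data.Nat.Properties using (_≤?_)
  open import Relation.Nullary using (Dec)

  -- f(m, k + 1) ≤ x + ℓ for y = c + k + 1, multiplied out by m (k + 1).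
  WithinBudget : (x c k ℓ m : ℕ) → Set
  WithinBudget x c k ℓ m = k * suc k * x + c * (m * (m + k)) ≤ suc k * (m * ℓ)

  within-budget? : ∀ x c k ℓ m → Dec (WithinBudget x c k ℓ m)
  within-budget? x c k ℓ m = _ ≤? _

module TwoColumns where
  open import Data.Nat.Base
  open import Data.Nat.Properties
  open import Data.Nat.Tactic.RingSolver using (solve-∀)
  open import Data.Product.Base using (_,_)
  open import Relation.Binary.PropositionalEquality
  open import Relation.Nullary using (¬_; yes; no)
  open Budget using (WithinBudget)

  triangle : ℕ → ℕ
  triangle zero    = zero
  triangle (suc a) = suc a + triangle a

  pronic≡2*triangle : ∀ a → a * (a + 1) ≡ 2 * triangle a
  pronic≡2*triangle zero    = refl
  pronic≡2*triangle (suc a) = begin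
    suc a * (suc a + 1)         ≡⟨ unfold a ⟩
    2 * suc a + a * (a + 1)     ≡⟨ cong (2 * suc a +_) (pronic≡2*triangle a) ⟩
    2 * suc a + 2 * triangle a  ≡⟨ *-distribˡ-+ 2 (suc a) (triangle a) ⟨
    2 * triangle (suc a)        ∎
    where
    open ≡-Reasoning
    unfold : ∀ a → suc a * (suc a + 1) ≡ 2 * suc a + a * (a + 1)
    unfold = solve-∀

  exchange-identity : ∀ b x p d →
    (p + d) * (2 * x + b * (p * (p + 1))) + d * (b * (p * (p + d)))
      ≡ p * (2 * x + b * ((p + d) * (p + d + 1))) + d * (2 * x)
  exchange-identity = solve-∀

  rescale-identity : ∀ ℓ p d → (p + d) * (2 * (p * ℓ)) ≡ p * (2 * ((p + d) * ℓ))
  rescale-identity = solve-∀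

  halve-identity : ∀ x b t → 2 * x + b * (2 * t) ≡ 2 * (x + b * t)
  halve-identity = solve-∀

  single-row-identity : ∀ x b → 2 * x + b * (1 * (1 + 1)) ≡ 2 * (x + b)
  single-row-identity = solve-∀

  step-identity : ∀ b x s →
    2 * x + b * (s * (s + 1)) + 2 * (b * (s + 1)) ≡ 2 * x + b * ((s + 1) * (s + 1 + 1))
  step-identity = solve-∀

  split-identity : ∀ ℓ s → 2 * ((s + 1) * ℓ) ≡ 2 * (s * ℓ) + 2 * ℓ
  split-identity = solve-∀

  excess-identity : ∀ b s →
    b * (s * (s + 1)) + 2 * s + b * (s * (s + 1)) ≡ 2 * (s * suc (b * (s + 1)))
  excess-identity = solve-∀

  overshoot-identity : ∀ b′ s d →
    suc b′ * ((s + 1) * (s + 1 + suc d))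
      ≡ suc b′ * (s * (s + 1)) + 2 * s + (2 + 2 * (b′ * (s + 1)) + suc b′ * (d * (s + 1)))
  overshoot-identity = solve-∀

  overshoot-bound : ∀ b s d → 1 ≤ b →
    b * (s * (s + 1)) + 2 * s ≤ b * ((s + 1) * (s + 1 + suc d))
  overshoot-bound (suc b′) s d _ =
    subst (suc b′ * (s * (s + 1)) + 2 * s ≤_) (sym (overshoot-identity b′ s d)) (m≤m+n _ _)

  module _ (b x ℓ : ℕ) where

    private
      W : ℕ → Set
      W = WithinBudget x b 1 ℓ

    move-right : ∀ p d → .{{NonZero p}} → b * (p * (p + d)) ≤ 2 * x → W p → W (p + d)
    move-right p d bp[p+d]≤2x Wp = *-cancelˡ-≤ p (+-cancelʳ-≤ (d * (2 * x)) _ _ (begin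
      p * (2 * x + b * ((p + d) * (p + d + 1))) + d * (2 * x)
        ≡⟨ exchange-identity b x p d ⟨
      (p + d) * (2 * x + b * (p * (p + 1))) + d * (b * (p * (p + d)))
        ≤⟨ +-mono-≤ (*-monoʳ-≤ (p + d) Wp) (*-monoʳ-≤ d bp[p+d]≤2x) ⟩
      (p + d) * (2 * (p * ℓ)) + d * (2 * x)
        ≡⟨ cong (_+ d * (2 * x)) (rescale-identity ℓ p d) ⟩
      p * (2 * ((p + d) * ℓ)) + d * (2 * x)
        ∎))
      where open ≤-Reasoning

    move-left : ∀ p d → .{{NonZero (p + d)}} → 2 * x ≤ b * (p * (p + d)) → W (p + d) → W p
    move-left p d 2x≤bp[p+d] Wp+d =
      *-cancelˡ-≤ (p + d) (+-cancelʳ-≤ (d * (b * (p * (p + d)))) _ _ (begin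
        (p + d) * (2 * x + b * (p * (p + 1))) + d * (b * (p * (p + d)))
          ≡⟨ exchange-identity b x p d ⟩
        p * (2 * x + b * ((p + d) * (p + d + 1))) + d * (2 * x)
          ≤⟨ +-mono-≤ (*-monoʳ-≤ p Wp+d) (*-monoʳ-≤ d 2x≤bp[p+d]) ⟩
        p * (2 * ((p + d) * ℓ)) + d * (b * (p * (p + d)))
          ≡⟨ cong (_+ d * (b * (p * (p + d)))) (rescale-identity ℓ p d) ⟨
        (p + d) * (2 * (p * ℓ)) + d * (b * (p * (p + d)))
          ∎))
      where open ≤-Reasoning

    -- Both sides of W a are even, so a failure misses by at least 2.
    outside-by-two : ∀ a → ¬ W a → 2 * (a * ℓ) + 2 ≤ 2 * x + b * (a * (a + 1))
    outside-by-two a ¬Wa = begin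
      2 * (a * ℓ) + 2            ≡⟨ trans (+-comm (2 * (a * ℓ)) 2) (sym (*-suc 2 (a * ℓ))) ⟩
      2 * suc (a * ℓ)            ≤⟨ *-monoʳ-≤ 2 aℓ<x+bT ⟩
      2 * (x + b * T)            ≡⟨ even ⟨
      2 * x + b * (a * (a + 1))  ∎
      where
      open ≤-Reasoning
      T = triangle a
      even : 2 * x + b * (a * (a + 1)) ≡ 2 * (x + b * T)
      even = trans (cong (λ n → 2 * x + b * n) (pronic≡2*triangle a)) (halve-identity x b T)
      aℓ<x+bT : a * ℓ < x + b * T
      aℓ<x+bT = *-cancelˡ-< 2 (a * ℓ) (x + b * T) (subst (2 * (a * ℓ) <_) even (≰⇒> ¬Wa))

    single-row : x + b ≤ ℓ → W 1
    single-row x+b≤ℓ = begin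
      2 * x + b * (1 * (1 + 1))  ≡⟨ single-row-identity x b ⟩
      2 * (x + b)                ≤⟨ *-monoʳ-≤ 2 x+b≤ℓ ⟩
      2 * ℓ                      ≡⟨ cong (2 *_) (*-identityˡ ℓ) ⟨
      2 * (1 * ℓ)                ∎
      where open ≤-Reasoning

    step-left : ∀ s → 2 * x ≤ b * (s * (s + 1)) + 2 * s → W (s + 1) → W s
    step-left s 2x≤ Ws+1 with ℓ ≤? b * (s + 1)
    ... | yes ℓ≤b[s+1] = +-cancelʳ-≤ (2 * (b * (s + 1))) _ _ (begin
      2 * x + b * (s * (s + 1)) + 2 * (b * (s + 1))  ≡⟨ step-identity b x s ⟩
      2 * x + b * ((s + 1) * (s + 1 + 1))            ≤⟨ Ws+1 ⟩
      2 * ((s + 1) * ℓ)                              ≡⟨ split-identity ℓ s ⟩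
      2 * (s * ℓ) + 2 * ℓ                            ≤⟨ +-monoʳ-≤ (2 * (s * ℓ)) (*-monoʳ-≤ 2 ℓ≤b[s+1]) ⟩
      2 * (s * ℓ) + 2 * (b * (s + 1))                ∎)
      where open ≤-Reasoning
    ... | no ℓ≰b[s+1] = begin
      2 * x + b * (s * (s + 1))                      ≤⟨ +-monoˡ-≤ (b * (s * (s + 1))) 2x≤ ⟩
      b * (s * (s + 1)) + 2 * s + b * (s * (s + 1))  ≡⟨ excess-identity b s ⟩
      2 * (s * suc (b * (s + 1)))                    ≤⟨ *-monoʳ-≤ 2 (*-monoʳ-≤ s (≰⇒> ℓ≰b[s+1])) ⟩
      2 * (s * ℓ)                                    ∎
      where open ≤-Reasoning

    minimum-at : ∀ s₀ m → 1 ≤ b → b * (s₀ * suc s₀) + 2 * s₀ < 2 * x →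
      2 * x ≤ b * (suc s₀ * (suc s₀ + 1)) + 2 * suc s₀ → .{{NonZero m}} → W m → W (suc s₀)
    minimum-at s₀ m 1≤b lower upper Wm with m ≤? s₀
    ... | yes m≤s₀ = let d , m+d≡s = m≤n⇒∃[o]m+o≡n (m≤n⇒m≤1+n m≤s₀) in
      subst W m+d≡s (move-right m d (subst (λ n → b * (m * n) ≤ 2 * x) (sym m+d≡s) bms≤2x) Wm)
      where
      bms≤2x : b * (m * suc s₀) ≤ 2 * x
      bms≤2x = ≤-trans (*-monoʳ-≤ b (*-monoˡ-≤ (suc s₀) m≤s₀)) (≤-trans (m≤m+n _ _) (<⇒≤ lower))
    ... | no m≰s₀ = let d , s+d≡m = m≤n⇒∃[o]m+o≡n (≰⇒> m≰s₀) in
      from-right d (subst W (sym s+d≡m) Wm)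
      where
      s = suc s₀
      from-right : ∀ d → W (s + d) → W s
      from-right zero          Ws+d = subst W (+-identityʳ s) Ws+d
      from-right (suc zero)    Ws+1 = step-left s upper Ws+1
      from-right (suc (suc d)) Ws+d = step-left s upper (move-left (s + 1) (suc d)
        (≤-trans upper (overshoot-bound b s d 1≤b)) (subst W (sym (+-assoc s 1 (suc d))) Ws+d))

module ColumnReduction where
  open import Data.Nat.Base
  open import Data.Nat.Properties
  open import Data.Nat.DivMod using (_/_; _%_; m≡m%n+[m/n]*n; m%n<n)
  open import Data.Nat.Tactic.RingSolver using (solve-∀)
  open import Data.Product.Base using (∃; _×_; _,_)
  open import Data.Empty using (⊥-elim)
  open import Relation.Binary.PropositionalEquality
  open import Relation.Nullary using (¬_; yes; no)
  open Budget using (WithinBudget; within-budget?)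
  open TwoColumns using (outside-by-two; single-row; minimum-at)

  few-columns-identity : ∀ m₀ d g e →
    let m = suc m₀; q = m + d; k = suc q; x = m + g in
    k * suc k * x + suc (2 * q + e) * (m * (m + k))
      ≡ suc k * (m * (x + suc (3 * q + e))) + (suc k * (suc d * g) + m * (m₀ * (m₀ + d + e)))
  few-columns-identity = solve-∀

  few-columns : ∀ q e x ℓ m → .{{NonZero m}} → m ≤ q → m ≤ x →
    WithinBudget x (suc (2 * q + e)) (suc q) ℓ m → x + suc (3 * q + e) ≤ ℓ
  few-columns _ e _ ℓ (suc m₀) m≤q m≤x W[m] with m≤n⇒∃[o]m+o≡n m≤q | m≤n⇒∃[o]m+o≡n m≤x
  ... | d , refl | g , refl = *-cancelˡ-≤ m (*-cancelˡ-≤ (suc k) (begin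
    suc k * (m * (x + b))
      ≤⟨ m≤m+n _ _ ⟩
    suc k * (m * (x + b)) + (suc k * (suc d * g) + m * (m₀ * (m₀ + d + e)))
      ≡⟨ few-columns-identity m₀ d g e ⟨
    k * suc k * x + suc (2 * q + e) * (m * (m + k))
      ≤⟨ W[m] ⟩
    suc k * (m * ℓ)
      ∎))
    where
    open ≤-Reasoning
    m = suc m₀
    q = m + d
    k = suc q
    x = m + g
    b = suc (3 * q + e)

  combination-left-identity : ∀ r w a e x ℓ →
    let q = r + w; k = suc q; A = suc a; m = r + A * k; c = suc (2 * q + e) in
    suc k * (suc w * (2 * (A * ℓ) + 2) + r * (2 * ((A + 1) * ℓ) + 2))
      + 2 * (k * suc k * x + c * (m * (m + k)))
    ≡ (2 * (k * suc k * x) + 2 * (suc k * (m * ℓ))) + (2 * (k * suc k) + 2 * (c * (m * (m + k))))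
  combination-left-identity = solve-∀

  combination-right-identity : ∀ r w a e x ℓ →
    let q = r + w; k = suc q; A = suc a; m = r + A * k; b = suc (3 * q + e) in
    suc k * (suc w * (2 * x + b * (A * (A + 1))) + r * (2 * x + b * ((A + 1) * (A + 1 + 1))))
      + 2 * (suc k * (m * ℓ))
    ≡ (2 * (k * suc k * x) + 2 * (suc k * (m * ℓ))) + suc k * (b * ((A + 1) * (m + r)))
  combination-right-identity = solve-∀

  -- Each surplus has nonnegative coefficients in the case's variables. Opaque, because
  -- unfolding these solver proofs while checking the case split of interpolation-bound blows up.
  opaque
    interpolation-surplus₀₀ : ∀ a e →
      let r = 0; w = 0; q = r + w; k = suc q; A = suc a; m = r + A * k in
      2 * (k * suc k) + 2 * (suc (2 * q + e) * (m * (m + k)))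
        ≡ suc k * (suc (3 * q + e) * ((A + 1) * (m + r))) + 4
    interpolation-surplus₀₀ = solve-∀

    interpolation-surplus₀ : ∀ w a e →
      let r = 0; q = r + suc w; k = suc q; A = suc a; m = r + A * k in
      2 * (k * suc k) + 2 * (suc (2 * q + e) * (m * (m + k)))
        ≡ suc k * (suc (3 * q + e) * ((A + 1) * (m + r)))
          + (2 * (k * suc k) + A * (A + 1) * k * q * (w + e))
    interpolation-surplus₀ = solve-∀

    interpolation-surplus : ∀ r w a e →
      let q = suc r + w; k = suc q; A = suc a; m = suc r + A * k in
      2 * (k * suc k) + 2 * (suc (2 * q + e) * (m * (m + k)))
        ≡ suc k * (suc (3 * q + e) * ((A + 1) * (m + suc r)))
          + (2 * (3 + 4 * w + 7 * w * r + 5 * w * r * r + 4 * w * w + 3 * w * w * r + w * w * w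
                    + 4 * r + 6 * r * r + 3 * r * r * r)
             + e * (A * (A + 1) * k * q + 2 * suc r * (A * q + r))
             + q * (r + w) * a * (k * A + 2 * k + 2 * suc r))
    interpolation-surplus = solve-∀

  <-by-surplus : ∀ {m n d} → 0 < d → n ≡ m + d → m < n
  <-by-surplus {m} 0<d refl = m<m+n m 0<d

  interpolation-bound : ∀ r w a e →
    let q = r + w; k = suc q; A = suc a; m = r + A * k in
    suc k * (suc (3 * q + e) * ((A + 1) * (m + r)))
      < 2 * (k * suc k) + 2 * (suc (2 * q + e) * (m * (m + k)))
  interpolation-bound zero    zero    a e = <-by-surplus z<s (interpolation-surplus₀₀ a e)
  interpolation-bound zero    (suc w) a e = <-by-surplus z<s (interpolation-surplus₀ w a e)
  interpolation-bound (suc r) w       a e = <-by-surplus z<s (interpolation-surplus r w a e)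

  -- With m = r + A k, weighting the failures at A and A + 1 by k − r = w + 1 and r and adding
  -- twice the budget at m cancels x and ℓ, leaving the reverse of interpolation-bound.
  interpolation-impossible : ∀ r w a e x ℓ →
    let q = r + w; k = suc q; A = suc a; b = suc (3 * q + e) in
    ¬ WithinBudget x b 1 ℓ A → ¬ WithinBudget x b 1 ℓ (A + 1) →
    ¬ WithinBudget x (suc (2 * q + e)) k ℓ (r + A * k)
  interpolation-impossible r w a e x ℓ ¬W[A] ¬W[A+1] W[m] =
    <⇒≱ (interpolation-bound r w a e) (+-cancelˡ-≤ T _ _ (begin
      T + (2 * (k * suc k) + 2 * (c * (m * (m + k))))
        ≡⟨ combination-left-identity r w a e x ℓ ⟨
      suc k * (suc w * (2 * (A * ℓ) + 2) + r * (2 * ((A + 1) * ℓ) + 2))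
        + 2 * (k * suc k * x + c * (m * (m + k)))
        ≤⟨ +-mono-≤ (*-monoʳ-≤ (suc k) (+-mono-≤ (*-monoʳ-≤ (suc w) gap[A]) (*-monoʳ-≤ r gap[A+1])))
                    (*-monoʳ-≤ 2 W[m]) ⟩
      suc k * (suc w * (2 * x + b * (A * (A + 1))) + r * (2 * x + b * ((A + 1) * (A + 1 + 1))))
        + 2 * (suc k * (m * ℓ))
        ≡⟨ combination-right-identity r w a e x ℓ ⟩
      T + suc k * (b * ((A + 1) * (m + r)))
        ∎))
    where
    open ≤-Reasoning
    q = r + w
    k = suc q
    A = suc a
    m = r + A * k
    b = suc (3 * q + e)
    c = suc (2 * q + e)
    T = 2 * (k * suc k * x) + 2 * (suc k * (m * ℓ))
    gap[A] : 2 * (A * ℓ) + 2 ≤ 2 * x + b * (A * (A + 1))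
    gap[A] = outside-by-two b x ℓ A ¬W[A]
    gap[A+1] : 2 * ((A + 1) * ℓ) + 2 ≤ 2 * x + b * ((A + 1) * (A + 1 + 1))
    gap[A+1] = outside-by-two b x ℓ (A + 1) ¬W[A+1]

  reduce-to-two-columns : ∀ q e x ℓ m → .{{NonZero m}} → m ≤ x →
    WithinBudget x (suc (2 * q + e)) (suc q) ℓ m →
    ∃ λ m′ → NonZero m′ × WithinBudget x (suc (3 * q + e)) 1 ℓ m′
  reduce-to-two-columns q e x ℓ m m≤x W[m]
    with m / suc q | m % suc q | m≡m%n+[m/n]*n m (suc q) | m%n<n m (suc q)
  ... | zero  | r | m≡r+0 | r<k =
    1 , _ , single-row (suc (3 * q + e)) x ℓ (few-columns q e x ℓ m m≤q m≤x W[m])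
    where
    m≤q : m ≤ q
    m≤q = ≤-pred (subst (_< suc q) (sym (trans m≡r+0 (+-identityʳ r))) r<k)
  ... | suc a | r | refl  | r<k with m≤n⇒∃[o]m+o≡n (≤-pred r<k)
  ...   | w , refl with within-budget? x (suc (3 * (r + w) + e)) 1 ℓ (suc a)
  ...     | yes W[A] = suc a , _ , W[A]
  ...     | no ¬W[A] with within-budget? x (suc (3 * (r + w) + e)) 1 ℓ (suc a + 1)
  ...       | yes W[A+1] = suc a + 1 , _ , W[A+1]
  ...       | no ¬W[A+1] = ⊥-elim (interpolation-impossible r w a e x ℓ ¬W[A] ¬W[A+1] W[m])

  within-budget-at-optimum : ∀ q e s₀ x ℓ m → let b = suc (3 * q + e) in
    b * (s₀ * suc s₀) + 2 * s₀ < 2 * x → 2 * x ≤ b * (suc s₀ * (suc s₀ + 1)) + 2 * suc s₀ →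
    .{{NonZero m}} → m ≤ x → WithinBudget x (suc (2 * q + e)) (suc q) ℓ m →
    WithinBudget x b 1 ℓ (suc s₀)
  within-budget-at-optimum q e s₀ x ℓ m lower upper m≤x W[m]
    with reduce-to-two-columns q e x ℓ m m≤x W[m]
  ... | m′ , m′≢0 , W[m′] =
    minimum-at (suc (3 * q + e)) x ℓ s₀ m′ (s≤s z≤n) lower upper {{m′≢0}} W[m′]

module ClearingDenominators where
  open import Data.Nat.Base as ℕ using (ℕ; suc)
  open import Data.Integer.Base as ℤ using (+_; -[1+_]; 1ℤ; _+_; _*_; _-_; -_; _≤_; _<_)
  open import Data.Integer.Properties as ℤ using (+-monoˡ-≤)
  open import Data.Integer.Tactic.RingSolver using (solve-∀)
  open import Data.Rational.Base as ℚ using (ceiling)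
  open import Data.Product.Base using (Σ; _×_; _,_)
  open import Function.Base using (case_of_)
  open import Relation.Binary.PropositionalEquality
  open RationalExpression
  open NatPolynomial
  open Budget using (WithinBudget)

  -- On concrete expressions num and den compute to cross-multiplied forms, unit factors
  -- included; the left-hand sides of the identities below are exactly these forms.

  ‵f : ℕ → ℕ → ℕ → ℕ → Expr
  ‵f x y m₀ n₀ = (‵ x /1+ m₀ ‵+ ‵ y /1+ n₀ ‵- ‵1) ‵* (‵ (suc m₀ ℕ.+ suc n₀) ‵- ‵1)

  add-sub-identity : ∀ c b → c ≡ c + b - b
  add-sub-identity = solve-∀

  sub-add-identity : ∀ b d → b + d - b ≡ d
  sub-add-identity = solve-∀

  add-difference-identity : ∀ K X → K ≡ X + (K - X)
  add-difference-identity = solve-∀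

  ≤-shift : ∀ {a b c d} → a ≤ b → a + d ≡ c + b → c ≤ d
  ≤-shift {a} {b} {c} {d} a≤b a+d≡c+b = begin
    c          ≡⟨ add-sub-identity c b ⟩
    c + b - b  ≡⟨ cong (_- b) a+d≡c+b ⟨
    a + d - b  ≤⟨ +-monoˡ-≤ (- b) (+-monoˡ-≤ d a≤b) ⟩
    b + d - b  ≡⟨ sub-add-identity b d ⟩
    d          ∎
    where open ℤ.≤-Reasoning

  budget-identity : ∀ X C k M K →
    ((X * (1ℤ + k) + (C + (1ℤ + k)) * M) * 1ℤ + - 1ℤ * (M * (1ℤ + k)))
      * ((M + (1ℤ + k)) * 1ℤ + - 1ℤ * 1ℤ)
      + (1ℤ + k) * (M * (K - X))
    ≡ (k * (1ℤ + k) * X + C * (M * (M + k))) + K * (M * (1ℤ + k) * 1ℤ * (1ℤ * 1ℤ))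
  budget-identity = solve-∀

  budget-identity′ : ∀ X C k M L →
    (k * (1ℤ + k) * X + C * (M * (M + k))) + (X + L) * (M * (1ℤ + k) * 1ℤ * (1ℤ * 1ℤ))
    ≡ ((X * (1ℤ + k) + (C + (1ℤ + k)) * M) * 1ℤ + - 1ℤ * (M * (1ℤ + k)))
        * ((M + (1ℤ + k)) * 1ℤ + - 1ℤ * 1ℤ)
      + (1ℤ + k) * (M * L)
  budget-identity′ = solve-∀

  budget-cost : (x c k m : ℕ) → Poly
  budget-cost x c k m = ⌜ k ⌝ :* ⌜ suc k ⌝ :* ⌜ x ⌝ :+ ⌜ c ⌝ :* (⌜ m ⌝ :* (⌜ m ⌝ :+ ⌜ k ⌝))

  budget-allowance : (k m ℓ : ℕ) → Poly
  budget-allowance k m ℓ = ⌜ suc k ⌝ :* (⌜ m ⌝ :* ⌜ ℓ ⌝)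

  num≤⇒within-budget : ∀ x c k m₀ K →
    num (‵f x (c ℕ.+ suc k) m₀ k) ≤ K * den (‵f x (c ℕ.+ suc k) m₀ k) →
    Σ ℕ λ ℓ → K ≡ + x + + ℓ × WithinBudget x c k ℓ (suc m₀)
  num≤⇒within-budget x c k m₀ K num≤
    with K - + x | add-difference-identity K (+ x)
       | ≤-shift num≤ (budget-identity (+ x) (+ c) (+ k) (+ suc m₀) K)
  ... | + ℓ      | K≡x+ℓ | cost≤ =
    ℓ , K≡x+ℓ , ≤-fromℤ (budget-cost x c k (suc m₀)) (budget-allowance k (suc m₀) ℓ) cost≤
  ... | -[1+ n ] | _     | cost≤ =
    case subst (_≤ _) (⟦⟧ℤ≡+⟦⟧ℕ (budget-cost x c k (suc m₀))) cost≤ of λ ()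

  within-budget⇒num≤ : ∀ x c k m₀ ℓ → WithinBudget x c k ℓ (suc m₀) →
    num (‵f x (c ℕ.+ suc k) m₀ k) ≤ (+ x + + ℓ) * den (‵f x (c ℕ.+ suc k) m₀ k)
  within-budget⇒num≤ x c k m₀ ℓ W =
    ≤-shift (≤-toℤ (budget-cost x c k (suc m₀)) (budget-allowance k (suc m₀) ℓ) W)
            (budget-identity′ (+ x) (+ c) (+ k) (+ suc m₀) (+ ℓ))

  ceiling≤⇒within-budget : ∀ x y c k m₀ K → c ℕ.+ suc k ≡ y →
    ceiling ⟦ ‵f x y m₀ k ⟧ℚ ≤ K → Σ ℕ λ ℓ → K ≡ + x + + ℓ × WithinBudget x c k ℓ (suc m₀)
  ceiling≤⇒within-budget x _ c k m₀ K refl ⌈f⌉≤K =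
    num≤⇒within-budget x c k m₀ K (ceiling≤⇒num≤ (‵f x (c ℕ.+ suc k) m₀ k) K ⌈f⌉≤K)

  within-budget⇒ceiling≤ : ∀ x y c k m₀ ℓ → c ℕ.+ suc k ≡ y →
    WithinBudget x c k ℓ (suc m₀) → ceiling ⟦ ‵f x y m₀ k ⟧ℚ ≤ + x + + ℓ
  within-budget⇒ceiling≤ x _ c k m₀ ℓ refl W =
    num≤⇒ceiling≤ (‵f x (c ℕ.+ suc k) m₀ k) (+ x + + ℓ) (within-budget⇒num≤ x c k m₀ ℓ W)

  ‵lower ‵upper : ℕ → ℕ → Expr
  ‵lower s y = ((‵ s ‵- ‵1) ‵* ‵ s) ‵* (‵ y /1+ 1 ‵- ‵1) ‵+ ‵ s ‵- ‵1
  ‵upper s y = (‵ s ‵* ‵ (s ℕ.+ 1)) ‵* (‵ y /1+ 1 ‵- ‵1) ‵+ ‵ s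

  lower-identity : ∀ S₀ B →
    (((((1ℤ + S₀) * 1ℤ + - 1ℤ * 1ℤ) * (1ℤ + S₀)) * ((+ 2 + B) * 1ℤ + - 1ℤ * + 2) * 1ℤ
      + (1ℤ + S₀) * (1ℤ * 1ℤ * 1ℤ * (+ 2 * 1ℤ))) * 1ℤ
      + - 1ℤ * (1ℤ * 1ℤ * 1ℤ * (+ 2 * 1ℤ) * 1ℤ)) * 1ℤ
    ≡ B * (S₀ * (1ℤ + S₀)) + + 2 * S₀
  lower-identity = solve-∀

  upper-identity : ∀ S₀ B →
    (((1ℤ + S₀) * ((1ℤ + S₀) + 1ℤ)) * ((+ 2 + B) * 1ℤ + - 1ℤ * + 2) * 1ℤ
      + (1ℤ + S₀) * (1ℤ * 1ℤ * (+ 2 * 1ℤ))) * 1ℤ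
    ≡ B * ((1ℤ + S₀) * ((1ℤ + S₀) + 1ℤ)) + + 2 * (1ℤ + S₀)
  upper-identity = solve-∀

  lower-denominator-identity : ∀ X → X * (1ℤ * 1ℤ * 1ℤ * (+ 2 * 1ℤ) * 1ℤ * 1ℤ) ≡ + 2 * X
  lower-denominator-identity = solve-∀

  upper-denominator-identity : ∀ X → X * (1ℤ * 1ℤ * (+ 2 * 1ℤ) * 1ℤ) ≡ + 2 * X
  upper-denominator-identity = solve-∀

  lower-bound⇒ℕ : ∀ s₀ b x → ⟦ ‵lower (suc s₀) (suc (suc b)) ⟧ℚ ℚ.< ⟦ ‵ x ⟧ℚ →
    b ℕ.* (s₀ ℕ.* suc s₀) ℕ.+ 2 ℕ.* s₀ ℕ.< 2 ℕ.* x
  lower-bound⇒ℕ s₀ b x lower =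
    <-fromℤ (⌜ b ⌝ :* (⌜ s₀ ⌝ :* ⌜ suc s₀ ⌝) :+ ⌜ 2 ⌝ :* ⌜ s₀ ⌝) (⌜ 2 ⌝ :* ⌜ x ⌝)
      (subst₂ _<_ (lower-identity (+ s₀) (+ b)) (lower-denominator-identity (+ x))
        (<⇒cross-< (‵lower (suc s₀) (suc (suc b))) (‵ x) lower))

  upper-bound⇒ℕ : ∀ s₀ b x → ⟦ ‵ x ⟧ℚ ℚ.≤ ⟦ ‵upper (suc s₀) (suc (suc b)) ⟧ℚ →
    2 ℕ.* x ℕ.≤ b ℕ.* (suc s₀ ℕ.* (suc s₀ ℕ.+ 1)) ℕ.+ 2 ℕ.* suc s₀
  upper-bound⇒ℕ s₀ b x upper =
    ≤-fromℤ (⌜ 2 ⌝ :* ⌜ x ⌝) (⌜ b ⌝ :* (⌜ suc s₀ ⌝ :* (⌜ suc s₀ ⌝ :+ ⌜ 1 ⌝)) :+ ⌜ 2 ⌝ :* ⌜ suc s₀ ⌝)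
      (subst₂ _≤_ (upper-denominator-identity (+ x)) (upper-identity (+ s₀) (+ b))
        (≤⇒cross-≤ (‵ x) (‵upper (suc s₀) (suc (suc b))) upper))

  column-identityˡ : ∀ N → N * (+ 3 * 1ℤ) ≡ + 3 * N
  column-identityˡ = solve-∀

  column-identityʳ : ∀ Y → (Y * 1ℤ + 1ℤ * + 3) * 1ℤ ≡ Y + + 3
  column-identityʳ = solve-∀

  column-bound⇒ℕ : ∀ n y → ⟦ ‵ n ⟧ℚ ℚ.≤ ⟦ ‵ y /1+ 2 ‵+ ‵1 ⟧ℚ → 3 ℕ.* n ℕ.≤ y ℕ.+ 3
  column-bound⇒ℕ n y n≤ = ≤-fromℤ (⌜ 3 ⌝ :* ⌜ n ⌝) (⌜ y ⌝ :+ ⌜ 3 ⌝)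
    (subst₂ _≤_ (column-identityˡ (+ n)) (column-identityʳ (+ y))
      (≤⇒cross-≤ (‵ n) (‵ y /1+ 2 ‵+ ‵1) n≤))

  ℕ⇒column-bound : ∀ n y → 3 ℕ.* n ℕ.≤ y ℕ.+ 3 → ⟦ ‵ n ⟧ℚ ℚ.≤ ⟦ ‵ y /1+ 2 ‵+ ‵1 ⟧ℚ
  ℕ⇒column-bound n y 3n≤y+3 = cross-≤⇒≤ (‵ n) (‵ y /1+ 2 ‵+ ‵1)
    (subst₂ _≤_ (sym (column-identityˡ (+ n))) (sym (column-identityʳ (+ y)))
      (≤-toℤ (⌜ 3 ⌝ :* ⌜ n ⌝) (⌜ y ⌝ :+ ⌜ 3 ⌝) 3n≤y+3))

  predecessor-identity : ∀ S → ((S + + 2) * 1ℤ + - 1ℤ * 1ℤ) * 1ℤ ≡ (S + 1ℤ) * (1ℤ * 1ℤ)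
  predecessor-identity = solve-∀

  ⟦2+⟧-1≡⟦1+⟧ : ∀ s → ⟦ ‵ (s ℕ.+ 2) ‵- ‵1 ⟧ℚ ≡ ⟦ ‵ (s ℕ.+ 1) ⟧ℚ
  ⟦2+⟧-1≡⟦1+⟧ s = cross-≡⇒≡ (‵ (s ℕ.+ 2) ‵- ‵1) (‵ (s ℕ.+ 1)) (predecessor-identity (+ s))

open import Defs
open import Data.Nat using (ℕ; _≤_; _+_)
open import Data.Integer using (ℤ) renaming (_≤_ to _≤ℤ_)
open import Data.Rational using (ℚ; 1ℚ; ceiling) renaming (_+_ to _+ℚ_; _*_ to _*ℚ_; _-_ to _-ℚ_; _<_ to _<ℚ_; _≤_ to _≤ℚ_)
open import Data.Product using (Σ; _×_; _,_)
open import Relation.Binary.PropositionalEquality using (_≡_; refl; sym; cong; subst; subst₂)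

open import Data.Nat.Base using (suc; z≤n; s≤s; _*_; _<_)
import Data.Nat.Properties as ℕ
open import Data.Nat.Tactic.RingSolver using (solve-∀)
open import Data.Integer.Properties using (≤-refl)
open RationalExpression using (⟦_⟧ℚ)
open ColumnReduction using (within-budget-at-optimum)
open ClearingDenominators

column-count-identity : ∀ q e → suc (2 * q + e) + suc (suc q) ≡ suc (suc (suc (3 * q + e)))
column-count-identity = solve-∀

column-bound⇒3q≤b₀ : ∀ q b₀ → 3 * suc (suc q) ≤ suc (suc (suc b₀)) + 3 → 3 * q ≤ b₀
column-bound⇒3q≤b₀ q b₀ 3n≤y+3 = ℕ.+-cancelʳ-≤ 6 (3 * q) b₀ (subst₂ _≤_ (left q) (right b₀) 3n≤y+3)
  where
  left : ∀ q → 3 * suc (suc q) ≡ 3 * q + 6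
  left = solve-∀
  right : ∀ b₀ → suc (suc (suc b₀)) + 3 ≡ b₀ + 6
  right = solve-∀

ceiling-at-optimum≤ : ∀ x b₀ s₀ m₀ q → let b = suc b₀; y = suc (suc b) in
  b * (s₀ * suc s₀) + 2 * s₀ < 2 * x → 2 * x ≤ b * (suc s₀ * (suc s₀ + 1)) + 2 * suc s₀ →
  suc m₀ ≤ x → 3 * q ≤ b₀ →
  ceiling ⟦ ‵f x y s₀ 1 ⟧ℚ ≤ℤ ceiling ⟦ ‵f x y m₀ (suc q) ⟧ℚ
ceiling-at-optimum≤ x b₀ s₀ m₀ q lower upper m≤x 3q≤b₀ with ℕ.m≤n⇒∃[o]m+o≡n 3q≤b₀
... | e , refl
  with ceiling≤⇒within-budget x _ (suc (2 * q + e)) (suc q) m₀ _ (column-count-identity q e) ≤-refl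
...   | ℓ , K≡x+ℓ , W[m] = subst (ceiling ⟦ ‵f x y s₀ 1 ⟧ℚ ≤ℤ_) (sym K≡x+ℓ)
          (within-budget⇒ceiling≤ x y b 1 s₀ ℓ (ℕ.+-comm b 2)
            (within-budget-at-optimum q e s₀ x ℓ (suc m₀) lower upper m≤x W[m]))
  where
  b = suc (3 * q + e)
  y = suc (suc b)

lemma3p2 : (x y s : ℕ) → 1 ≤ x → 3 ≤ y → 1 ≤ s →
  (((⟦ s ⟧ -ℚ 1ℚ) *ℚ ⟦ s ⟧) *ℚ (y // 2 -ℚ 1ℚ)) +ℚ ⟦ s ⟧ -ℚ 1ℚ <ℚ ⟦ x ⟧ →
  ⟦ x ⟧ ≤ℚ ((⟦ s ⟧ *ℚ ⟦ s + 1 ⟧) *ℚ (y // 2 -ℚ 1ℚ)) +ℚ ⟦ s ⟧ →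
  (Σ ℕ λ m → Σ ℕ λ n → (1 ≤ m × m ≤ x) × (2 ≤ n × ⟦ n ⟧ ≤ℚ y // 3 +ℚ 1ℚ) ×
     ⌈ (x // m +ℚ y // n -ℚ 1ℚ) *ℚ (⟦ m + n ⟧ -ℚ 1ℚ) ⌉
       ≡ ⌈ (x // s +ℚ y // 2 -ℚ 1ℚ) *ℚ (⟦ s + 1 ⟧) ⌉)
  × ((m n : ℕ) → 1 ≤ m → m ≤ x → 2 ≤ n → ⟦ n ⟧ ≤ℚ y // 3 +ℚ 1ℚ →
     ⌈ (x // s +ℚ y // 2 -ℚ 1ℚ) *ℚ (⟦ s + 1 ⟧) ⌉
       ≤ℤ ⌈ (x // m +ℚ y // n -ℚ 1ℚ) *ℚ (⟦ m + n ⟧ -ℚ 1ℚ) ⌉)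
lemma3p2 x 0 _ _ () _ _ _
lemma3p2 x 1 _ _ (s≤s ()) _ _ _
lemma3p2 x 2 _ _ (s≤s (s≤s ())) _ _ _
lemma3p2 x (suc (suc (suc _))) 0 _ _ () _ _
lemma3p2 x y@(suc (suc (suc b₀))) s@(suc s₀) _ _ _ lo hi =
  (s , 2 , (s≤s z≤n , s≤x) , (ℕ.≤-refl , ℕ⇒column-bound 2 y 6≤y+3) , ⌈f[s,2]⌉≡⌈g⌉) , minimality
  where
  lower : suc b₀ * (s₀ * s) + 2 * s₀ < 2 * x
  lower = lower-bound⇒ℕ s₀ (suc b₀) x lo
  upper : 2 * x ≤ suc b₀ * (s * (s + 1)) + 2 * s
  upper = upper-bound⇒ℕ s₀ (suc b₀) x hi
  s≤x : s ≤ x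
  s≤x = ℕ.*-cancelˡ-< 2 s₀ x (ℕ.≤-<-trans (ℕ.m≤n+m (2 * s₀) (suc b₀ * (s₀ * s))) lower)
  6≤y+3 : 3 * 2 ≤ y + 3
  6≤y+3 = s≤s (s≤s (s≤s (ℕ.m≤n+m 3 b₀)))
  ⌈f[s,2]⌉≡⌈g⌉ : ⌈ (x // s +ℚ y // 2 -ℚ 1ℚ) *ℚ (⟦ s + 2 ⟧ -ℚ 1ℚ) ⌉
                 ≡ ⌈ (x // s +ℚ y // 2 -ℚ 1ℚ) *ℚ ⟦ s + 1 ⟧ ⌉
  ⌈f[s,2]⌉≡⌈g⌉ = cong (λ t → ⌈ (x // s +ℚ y // 2 -ℚ 1ℚ) *ℚ t ⌉) (⟦2+⟧-1≡⟦1+⟧ s)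
  minimality : (m n : ℕ) → 1 ≤ m → m ≤ x → 2 ≤ n → ⟦ n ⟧ ≤ℚ y // 3 +ℚ 1ℚ →
    ⌈ (x // s +ℚ y // 2 -ℚ 1ℚ) *ℚ ⟦ s + 1 ⟧ ⌉ ≤ℤ ⌈ (x // m +ℚ y // n -ℚ 1ℚ) *ℚ (⟦ m + n ⟧ -ℚ 1ℚ) ⌉
  minimality 0        _             ()  _   _        _
  minimality (suc m₀) 0             _   _   ()       _
  minimality (suc m₀) 1             _   _   (s≤s ()) _
  minimality (suc m₀) (suc (suc q)) _   m≤x _        n≤y/3+1 = subst (_≤ℤ _) ⌈f[s,2]⌉≡⌈g⌉
    (ceiling-at-optimum≤ x b₀ s₀ m₀ q lower upper m≤x
      (column-bound⇒3q≤b₀ q b₀ (column-bound⇒ℕ (suc (suc q)) y n≤y/3+1)))
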